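{- Let $n\ge 4$ and $2\le k\le n-2$. Let $\mathfrak{d}_{n,k}$ be the number of parity alternating derangements (PADs) of $[n]$ with exactly $k$ excedances, and let $d_{m,i}$ be the number of derangements of $[m]$ with exactly $i$ excedances. Then \[ \mathfrak{d}_{n,k}=\begin{cases}\displaystyle\sum_{i=1}^{k-1}d_{\lceil n/2\rceil,i}\,d_{\lfloor n/2\rfloor,k-i}, & \text{if } 2\le k\le\lfloor n/2\rfloor,\\[2mm] \displaystyle\sum_{i=1}^{n-k-1}d_{\lceil n/2\rceil,i}\,d_{\lfloor n/2\rfloor,n-k-i}, & \text{if } \lfloor n/2\rfloor<k\le n-2.\end{cases} \]
   Context: A permutation $\sigma$ of $[n]=\{1,\dots,n\}$, in one-line notation, is a PAP if $\sigma(i)\equiv i\pmod 2$ for all $i$ (entries alternate in parity, first entry odd); a PAD is a PAP with $\sigma(i)\ne i$ for all $i$. An excedance of a permutation $\sigma$ is an index $i$ with $\sigma(i)>i$. Here $d_{m,i}=0$ whenever no derangement of $[m]$ has $i$ excedances. -}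

module Defs where

open import Data.Nat using (ℕ; zero; suc; _+_; _*_; _%_)
import Data.Nat as ℕ
open import Data.Fin using (Fin; toℕ; _<?_)
import Data.Fin.Properties as FinP
open import Data.Vec using (Vec; []; _∷_; lookup; toList)
open import Data.List using (List; []; _∷_; [_]; map; concatMap; length; filter; allFin)
open import Data.List.Relation.Unary.Unique.Propositional using (Unique)
open import Data.List.Relation.Unary.Unique.Propositional.Properties using ()
import Data.List.Relation.Unary.Unique.DecPropositional as UDec
open import Relation.Binary.PropositionalEquality using (_≡_; _≢_)
open import Relation.Nullary using (Dec; ¬?)
open import Relation.Nullary.Decidable using (_×-dec_)
open import Data.Product using (_×_)

-- Conventions: [n] = {1,…,n} is represented by Fin n via i ↦ toℕ i + 1.
-- A permutation in one-line notation is a vector σ : Vec (Fin n) n with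
-- pairwise distinct entries (σ(i) = lookup σ i).  Shifting all values by 1
-- preserves parity agreement σ(i) ≡ i (mod 2), fixed points and excedances.

allVecs : (m n : ℕ) → List (Vec (Fin n) m)
allVecs zero    n = [ [] ]
allVecs (suc m) n = concatMap (λ x → map (x ∷_) (allVecs m n)) (allFin n)

IsPerm : {n : ℕ} → Vec (Fin n) n → Set
IsPerm σ = Unique (toList σ)

isPerm? : {n : ℕ} → (σ : Vec (Fin n) n) → Dec (IsPerm σ)
isPerm? {n} σ = UDec.unique? FinP._≟_ (toList σ)

IsDerangement : {n : ℕ} → Vec (Fin n) n → Set
IsDerangement {n} σ = (i : Fin n) → lookup σ i ≢ i

isDerangement? : {n : ℕ} → (σ : Vec (Fin n) n) → Dec (IsDerangement σ)
isDerangement? {n} σ = FinP.all? (λ i → ¬? (lookup σ i FinP.≟ i))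

IsPAP : {n : ℕ} → Vec (Fin n) n → Set
IsPAP {n} σ = (i : Fin n) → toℕ (lookup σ i) % 2 ≡ toℕ i % 2

isPAP? : {n : ℕ} → (σ : Vec (Fin n) n) → Dec (IsPAP σ)
isPAP? {n} σ = FinP.all? (λ i → toℕ (lookup σ i) % 2 ℕ.≟ toℕ i % 2)

exc : {n : ℕ} → Vec (Fin n) n → ℕ
exc {n} σ = length (filter (λ i → i <? lookup σ i) (allFin n))

d : ℕ → ℕ → ℕ
d m i = length (filter (λ σ → isPerm? σ ×-dec (isDerangement? σ ×-dec (exc σ ℕ.≟ i))) (allVecs m m))

pad : ℕ → ℕ → ℕ
pad n k = length (filter (λ σ → isPerm? σ ×-dec (isPAP? σ ×-dec (isDerangement? σ ×-dec (exc σ ℕ.≟ k)))) (allVecs n n))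

Σ1to : ℕ → (ℕ → ℕ) → ℕ
Σ1to zero    f = 0
Σ1to (suc m) f = Σ1to m f + f (suc m)

-- A PAP of [n] maps odd positions to odd values and even positions to even values, so it is
-- the interleaving of a permutation α of the ⌈n/2⌉ odd positions and a permutation β of the
-- ⌊n/2⌋ even positions.  Relabelling 2a+1 ↦ a and 2b+2 ↦ b preserves order, so σ is a
-- derangement iff α and β are, and exc σ = exc α + exc β.  Hence the number of PADs with k
-- excedances is the convolution Σ_{i=0}^{k} d_{⌈n/2⌉,i} d_{⌊n/2⌋,k-i}, whose terms i = 0 and
-- i = k vanish because a derangement of a nonempty set has an excedance at its first position.
-- This proves the first formula for every k ≥ 1.  The second follows from the reverse
-- complement σ ↦ (i ↦ n+1-σ(n+1-i)): it preserves PADs (i and σ(i) change parity together) and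
-- turns the k excedances of a derangement into n-k.
module Submission where

open import Defs
open import Data.Nat
  using ( ℕ; zero; suc; _+_; _*_; _∸_; _≤_; _<_; _%_; _≟_; _≤?_; z≤n; s≤s; s<s; s<s⁻¹; ⌊_/2⌋;
        ⌈_/2⌉ )
open import Data.Nat.Properties
  using ( +-suc; +-assoc; +-comm; +-identityʳ; *-comm; *-zeroʳ; *-cancelʳ-≡; *-cancelʳ-<;
        *-monoˡ-<; suc-injective; ≤-refl; ≤-reflexive; ≤-antisym; ≤-trans; ≰⇒>; <⇒≱; ≮⇒≥; n≤0⇒n≡0;
        m≤n⇒m≤1+n; m≤m+n; m+n∸m≡n; m+[n∸m]≡n; m∸n+n≡m; m∸[m∸n]≡n; n∸n≡0; m<n⇒0<n∸m; m<n⇒n≢0;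
        m+n≤o⇒m≤o∸n; m≤o∸n⇒m+n≤o )
open import Data.Nat.DivMod using (%-distribˡ-+; [m+kn]%n≡m%n; m*n%n≡0)
open import Data.Fin using (Fin; zero; toℕ; fromℕ<; opposite; _<?_)
import Data.Fin as Fin
open import Data.Fin.Properties
  using ( toℕ-fromℕ<; toℕ-injective; toℕ<n; opposite-prop; opposite-involutive; ≤∧≢⇒<; <-asym )
open import Data.Vec using (Vec; []; _∷_; lookup; tabulate; toList)
open import Data.Vec.Properties using (∷-injective; lookup∘tabulate; tabulate-cong; tabulate∘lookup)
import Data.Vec.Relation.Unary.All.Properties as VecAll
open import Data.Vec.Relation.Unary.AllPairs using ([]; _∷_)
import Data.Vec.Relation.Unary.Unique.Propositional as Vec
import Data.Vec.Relation.Unary.Unique.Propositional.Properties as VecUnique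
open import Data.List
  using ( List; []; _∷_; map; filter; length; _++_; concatMap; cartesianProductWith;
        cartesianProduct; allFin )
open import Data.List.Properties
  using ( filter-++; filter-none; filter-≐; filter-some; length-++; length-map; length-tabulate )
open import Data.List.Membership.Propositional using (_∈_)
open import Data.List.Membership.Propositional.Properties
  using ( ∈-allFin; ∈-map⁺; ∈-map⁻; ∈-filter⁺; ∈-filter⁻; ∈-++⁺ˡ; ∈-++⁺ʳ; ∈-concatMap⁺;
        ∈-cartesianProduct⁺ )
open import Data.List.Membership.Propositional.Properties.WithK using (unique∧set⇒bag)
open import Data.List.Relation.Binary.BagAndSetEquality using (∼bag⇒↭)
open import Data.List.Relation.Binary.Permutation.Propositional.Properties using (↭-length)
open import Data.List.Relation.Unary.All as All using ([]; _∷_)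
import Data.List.Relation.Unary.All.Properties as AllP
import Data.List.Relation.Unary.Any as Any
open import Data.List.Relation.Unary.Any using (here; there)
open import Data.List.Relation.Unary.AllPairs using ([]; _∷_)
open import Data.List.Relation.Unary.Unique.Propositional using (Unique)
import Data.List.Relation.Unary.Unique.Propositional.Properties as Unique
open import Data.Product using (_×_; _,_; proj₁; proj₂; uncurry; assocʳ′; assocˡ′)
open import Data.Empty using (⊥-elim)
open import Function using (Injective; _∘_; id; const; mk⇔)
open import Relation.Nullary using (Dec; yes; no; ¬_)
open import Relation.Nullary.Decidable using (_×-dec_)
open import Relation.Unary using (Decidable; _≐_)
open import Relation.Unary.Properties using (∁?; _∩?_; _×?_)
open import Relation.Binary.PropositionalEquality
  using ( _≡_; _≢_; refl; sym; trans; cong; cong₂; subst; subst₂; module ≡-Reasoning )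

-- Counting in lists

count : {A : Set} {P : A → Set} → Decidable P → List A → ℕ
count P? xs = length (filter P? xs)

module _ {A : Set} {P : A → Set} (P? : Decidable P) where

  count-++ : ∀ xs ys → count P? (xs ++ ys) ≡ count P? xs + count P? ys
  count-++ xs ys = trans (cong length (filter-++ P? xs ys)) (length-++ (filter P? xs))

  count-∁ : ∀ xs → count P? xs + count (∁? P?) xs ≡ length xs
  count-∁ []       = refl
  count-∁ (x ∷ xs) with P? x
  ... | yes _ = cong suc (count-∁ xs)
  ... | no  _ = trans (+-suc _ _) (cong suc (count-∁ xs))

  count-none : ∀ xs → (∀ x → ¬ P x) → count P? xs ≡ 0
  count-none xs ¬P = cong length (filter-none P? (All.universal ¬P xs))

  count-split : {Q : A → Set} (Q? : Decidable Q) →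
                ∀ xs → count P? xs ≡ count (P? ∩? Q?) xs + count (P? ∩? ∁? Q?) xs
  count-split Q? []       = refl
  count-split Q? (x ∷ xs) with P? x | Q? x
  ... | yes _ | yes _ = cong suc (count-split Q? xs)
  ... | yes _ | no  _ = trans (cong suc (count-split Q? xs)) (sym (+-suc _ _))
  ... | no  _ | _     = count-split Q? xs

module _ {A B : Set} {P : B → Set} (P? : Decidable P) (f : A → B) where

  count-map : ∀ xs → count P? (map f xs) ≡ count (P? ∘ f) xs
  count-map []       = refl
  count-map (x ∷ xs) with P? (f x)
  ... | yes _ = cong suc (count-map xs)
  ... | no  _ = count-map xs

count-≐ : {A : Set} {P Q : A → Set} (P? : Decidable P) (Q? : Decidable Q) →
          P ≐ Q → ∀ xs → count P? xs ≡ count Q? xs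
count-≐ P? Q? P≐Q xs = cong length (filter-≐ P? Q? P≐Q xs)

record IsEnumeration {A : Set} (xs : List A) : Set where
  field
    unique   : Unique xs
    complete : ∀ x → x ∈ xs

open IsEnumeration

allFin-isEnumeration : ∀ n → IsEnumeration (allFin n)
allFin-isEnumeration n = record { unique = Unique.allFin⁺ n ; complete = ∈-allFin }

cartesianProduct-isEnumeration : {A B : Set} {xs : List A} {ys : List B} →
  IsEnumeration xs → IsEnumeration ys → IsEnumeration (cartesianProduct xs ys)
cartesianProduct-isEnumeration xs-enum ys-enum = record
  { unique   = Unique.cartesianProduct⁺ (unique xs-enum) (unique ys-enum)
  ; complete = λ (x , y) → ∈-cartesianProduct⁺ (complete xs-enum x) (complete ys-enum y)
  }

unique-map : {A B : Set} (f : A → B) {xs : List A} →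
             (∀ {x y} → x ∈ xs → y ∈ xs → f x ≡ f y → x ≡ y) →
             Unique xs → Unique (map f xs)
unique-map f {[]}     inj []         = []
unique-map f {x ∷ xs} inj (x∉ ∷ xs!) =
  AllP.map⁺ (All.tabulate λ y∈ fx≡fy → All.lookup x∉ y∈ (inj (here refl) (there y∈) fx≡fy))
  ∷ unique-map f (λ x∈ y∈ → inj (there x∈) (there y∈)) xs!

module _ {A B : Set} {xs : List A} {ys : List B} (f : A → B) (g : B → A)
         (f∈ : ∀ {x} → x ∈ xs → f x ∈ ys) (g∈ : ∀ {y} → y ∈ ys → g y ∈ xs)
         (g∘f : ∀ {x} → x ∈ xs → g (f x) ≡ x) (f∘g : ∀ {y} → y ∈ ys → f (g y) ≡ y) where

  length-inverseOn : Unique xs → Unique ys → length xs ≡ length ys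
  length-inverseOn xs! ys! = trans (sym (length-map f xs))
    (↭-length (∼bag⇒↭ (unique∧set⇒bag (unique-map f f-injectiveOn xs!) ys! (mk⇔ to from))))
    where
    f-injectiveOn : ∀ {x y} → x ∈ xs → y ∈ xs → f x ≡ f y → x ≡ y
    f-injectiveOn x∈ y∈ fx≡fy = trans (sym (g∘f x∈)) (trans (cong g fx≡fy) (g∘f y∈))
    to : ∀ {z} → z ∈ map f xs → z ∈ ys
    to z∈ with x , x∈ , refl ← ∈-map⁻ f z∈ = f∈ x∈
    from : ∀ {z} → z ∈ ys → z ∈ map f xs
    from z∈ = subst (_∈ map f xs) (f∘g z∈) (∈-map⁺ f (g∈ z∈))

module _ {A B : Set} {P : A → Set} {Q : B → Set} (P? : Decidable P) (Q? : Decidable Q)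
         {xs : List A} {ys : List B} (xs-enum : IsEnumeration xs) (ys-enum : IsEnumeration ys)
         (f : A → B) (g : B → A) (P⇒Q : ∀ {x} → P x → Q (f x)) (Q⇒P : ∀ {y} → Q y → P (g y))
         (g∘f : ∀ {x} → P x → g (f x) ≡ x) (f∘g : ∀ {y} → Q y → f (g y) ≡ y) where

  count-bijection : count P? xs ≡ count Q? ys
  count-bijection = length-inverseOn f g
    (λ x∈ → ∈-filter⁺ Q? (complete ys-enum _) (P⇒Q (P-of x∈)))
    (λ y∈ → ∈-filter⁺ P? (complete xs-enum _) (Q⇒P (Q-of y∈)))
    (g∘f ∘ P-of) (f∘g ∘ Q-of)
    (Unique.filter⁺ P? (unique xs-enum)) (Unique.filter⁺ Q? (unique ys-enum))
    where
    P-of : ∀ {x} → x ∈ filter P? xs → P x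
    P-of = proj₂ ∘ ∈-filter⁻ P? {xs = xs}
    Q-of : ∀ {y} → y ∈ filter Q? ys → Q y
    Q-of = proj₂ ∘ ∈-filter⁻ Q? {xs = ys}

Σ0to : ℕ → (ℕ → ℕ) → ℕ
Σ0to k g = g 0 + Σ1to k g

Σ1to-cong : ∀ k {g h : ℕ → ℕ} → (∀ {i} → i ≤ k → g i ≡ h i) → Σ1to k g ≡ Σ1to k h
Σ1to-cong zero    g≗h = refl
Σ1to-cong (suc k) g≗h = cong₂ _+_ (Σ1to-cong k (g≗h ∘ m≤n⇒m≤1+n)) (g≗h ≤-refl)

Σ0to-cong : ∀ k {g h : ℕ → ℕ} → (∀ {i} → i ≤ k → g i ≡ h i) → Σ0to k g ≡ Σ0to k h
Σ0to-cong k g≗h = cong₂ _+_ (g≗h z≤n) (Σ1to-cong k g≗h)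

Σ0to-suc : ∀ k (g : ℕ → ℕ) → Σ0to (suc k) g ≡ Σ0to k g + g (suc k)
Σ0to-suc k g = sym (+-assoc (g 0) (Σ1to k g) (g (suc k)))

module _ {A : Set} {P : A → Set} (P? : Decidable P) (h : A → ℕ) where

  count-≤-Σ0to : ∀ k xs →
    count (P? ∩? ((_≤? k) ∘ h)) xs ≡ Σ0to k (λ i → count (P? ∩? ((_≟ i) ∘ h)) xs)
  count-≤-Σ0to zero xs = begin
    count (P? ∩? ((_≤? 0) ∘ h)) xs
      ≡⟨ count-≐ _ _ ((λ (p , le) → p , n≤0⇒n≡0 le) , (λ (p , eq) → p , ≤-reflexive eq)) xs ⟩
    count (P? ∩? ((_≟ 0) ∘ h)) xs
      ≡⟨ sym (+-identityʳ (count (P? ∩? ((_≟ 0) ∘ h)) xs)) ⟩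
    Σ0to 0 (λ i → count (P? ∩? ((_≟ i) ∘ h)) xs) ∎
    where open ≡-Reasoning
  count-≤-Σ0to (suc k) xs = begin
    count (P? ∩? ((_≤? suc k) ∘ h)) xs
      ≡⟨ count-split _ ((_≤? k) ∘ h) xs ⟩
    count ((P? ∩? ((_≤? suc k) ∘ h)) ∩? ((_≤? k) ∘ h)) xs
      + count ((P? ∩? ((_≤? suc k) ∘ h)) ∩? ∁? ((_≤? k) ∘ h)) xs
      ≡⟨ cong₂ _+_ (count-≐ _ _ (drop-≤1+k , add-≤1+k) xs) (count-≐ _ _ (≡1+k , ≡1+k⁻¹) xs) ⟩
    count (P? ∩? ((_≤? k) ∘ h)) xs + count (P? ∩? ((_≟ suc k) ∘ h)) xs
      ≡⟨ cong₂ _+_ (count-≤-Σ0to k xs) refl ⟩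
    Σ0to k (λ i → count (P? ∩? ((_≟ i) ∘ h)) xs) + count (P? ∩? ((_≟ suc k) ∘ h)) xs
      ≡⟨ sym (Σ0to-suc k (λ i → count (P? ∩? ((_≟ i) ∘ h)) xs)) ⟩
    Σ0to (suc k) (λ i → count (P? ∩? ((_≟ i) ∘ h)) xs) ∎
    where
    open ≡-Reasoning
    drop-≤1+k : ∀ {x} → (P x × h x ≤ suc k) × h x ≤ k → P x × h x ≤ k
    drop-≤1+k ((p , _) , le) = p , le
    add-≤1+k : ∀ {x} → P x × h x ≤ k → (P x × h x ≤ suc k) × h x ≤ k
    add-≤1+k (p , le) = (p , m≤n⇒m≤1+n le) , le
    ≡1+k : ∀ {x} → (P x × h x ≤ suc k) × ¬ h x ≤ k → P x × h x ≡ suc k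
    ≡1+k ((p , le) , ≰) = p , ≤-antisym le (≰⇒> ≰)
    ≡1+k⁻¹ : ∀ {x} → P x × h x ≡ suc k → (P x × h x ≤ suc k) × ¬ h x ≤ k
    ≡1+k⁻¹ (p , eq) = (p , ≤-reflexive eq) , <⇒≱ (≤-reflexive (sym eq))

module _ {A B : Set} {P : A → Set} {Q : B → Set} (P? : Decidable P) (Q? : Decidable Q) where

  count-cartesianProduct : ∀ xs ys →
    count (P? ×? Q?) (cartesianProduct xs ys) ≡ count P? xs * count Q? ys
  count-cartesianProduct []       ys = refl
  count-cartesianProduct (x ∷ xs) ys = begin
    count (P? ×? Q?) (map (x ,_) ys ++ cartesianProduct xs ys)
      ≡⟨ count-++ (P? ×? Q?) (map (x ,_) ys) _ ⟩
    count (P? ×? Q?) (map (x ,_) ys) + count (P? ×? Q?) (cartesianProduct xs ys)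
      ≡⟨ cong₂ _+_ (count-map (P? ×? Q?) (x ,_) ys) (count-cartesianProduct xs ys) ⟩
    count (λ y → P? x ×-dec Q? y) ys + count P? xs * count Q? ys
      ≡⟨ first-row ⟩
    count P? (x ∷ xs) * count Q? ys ∎
    where
    open ≡-Reasoning
    first-row : count (λ y → P? x ×-dec Q? y) ys + count P? xs * count Q? ys
              ≡ count P? (x ∷ xs) * count Q? ys
    first-row with P? x
    ... | yes p = cong (_+ _) (count-≐ _ Q? (proj₂ , (p ,_)) ys)
    ... | no ¬p = cong (_+ _) (count-none _ ys (λ _ → ¬p ∘ proj₁))

module _ {A B : Set} {P : A → Set} {Q : B → Set} (P? : Decidable P) (Q? : Decidable Q)
         (h₁ : A → ℕ) (h₂ : B → ℕ) where

  count-convolution : ∀ k xs ys →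
    count ((P? ×? Q?) ∩? (λ (x , y) → h₁ x + h₂ y ≟ k)) (cartesianProduct xs ys)
    ≡ Σ0to k (λ i → count (P? ∩? ((_≟ i) ∘ h₁)) xs * count (Q? ∩? ((_≟ k ∸ i) ∘ h₂)) ys)
  count-convolution k xs ys = begin
    count R? xys
      ≡⟨ count-≐ _ _ ((λ r → r , bounded r) , proj₁) xys ⟩
    count (R? ∩? ((_≤? k) ∘ h₁ ∘ proj₁)) xys
      ≡⟨ count-≤-Σ0to R? (h₁ ∘ proj₁) k xys ⟩
    Σ0to k (λ i → count (R? ∩? ((_≟ i) ∘ h₁ ∘ proj₁)) xys)
      ≡⟨ Σ0to-cong k (λ i≤k → count-≐ _ _ (split-level i≤k , join-level i≤k) xys) ⟩
    Σ0to k (λ i → count ((P? ∩? ((_≟ i) ∘ h₁)) ×? (Q? ∩? ((_≟ k ∸ i) ∘ h₂))) xys)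
      ≡⟨ Σ0to-cong k (λ {i} _ →
           count-cartesianProduct (P? ∩? ((_≟ i) ∘ h₁)) (Q? ∩? ((_≟ k ∸ i) ∘ h₂)) xs ys) ⟩
    Σ0to k (λ i → count (P? ∩? ((_≟ i) ∘ h₁)) xs * count (Q? ∩? ((_≟ k ∸ i) ∘ h₂)) ys) ∎
    where
    open ≡-Reasoning
    xys : List (A × B)
    xys = cartesianProduct xs ys
    R? : Decidable (λ (x , y) → (P x × Q y) × h₁ x + h₂ y ≡ k)
    R? = (P? ×? Q?) ∩? (λ (x , y) → h₁ x + h₂ y ≟ k)
    bounded : ∀ {x y} → (P x × Q y) × h₁ x + h₂ y ≡ k → h₁ x ≤ k
    bounded {x} {y} (_ , eq) = subst (h₁ x ≤_) eq (m≤m+n (h₁ x) (h₂ y))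
    split-level : ∀ {i x y} → i ≤ k → ((P x × Q y) × h₁ x + h₂ y ≡ k) × h₁ x ≡ i →
                  (P x × h₁ x ≡ i) × (Q y × h₂ y ≡ k ∸ i)
    split-level {x = x} {y} _ (((p , q) , eq) , refl) =
      (p , refl) , (q , trans (sym (m+n∸m≡n (h₁ x) (h₂ y))) (cong (_∸ h₁ x) eq))
    join-level : ∀ {i x y} → i ≤ k → (P x × h₁ x ≡ i) × (Q y × h₂ y ≡ k ∸ i) →
                 ((P x × Q y) × h₁ x + h₂ y ≡ k) × h₁ x ≡ i
    join-level i≤k ((p , refl) , (q , eq)) = ((p , q) , trans (cong (_ +_) eq) (m+[n∸m]≡n i≤k)) , refl

-- Permutations in one-line notation

OneLine : ℕ → Set
OneLine m = Vec (Fin m) m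

IsPermDerangement : {m : ℕ} → OneLine m → Set
IsPermDerangement σ = IsPerm σ × IsDerangement σ

isPermDerangement? : {m : ℕ} (σ : OneLine m) → Dec (IsPermDerangement σ)
isPermDerangement? σ = isPerm? σ ×-dec isDerangement? σ

IsPADWithExcedances : {n : ℕ} → ℕ → OneLine n → Set
IsPADWithExcedances k σ = IsPerm σ × IsPAP σ × IsDerangement σ × exc σ ≡ k

concatMap-map≡cartesianProductWith : {A B C : Set} (f : A → B → C) (xs : List A) (ys : List B) →
  concatMap (λ x → map (f x) ys) xs ≡ cartesianProductWith f xs ys
concatMap-map≡cartesianProductWith f []       ys = refl
concatMap-map≡cartesianProductWith f (x ∷ xs) ys =
  cong (map (f x) ys ++_) (concatMap-map≡cartesianProductWith f xs ys)

allVecs-isEnumeration : ∀ m n → IsEnumeration (allVecs m n)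
allVecs-isEnumeration m n = record { unique = allVecs-unique m ; complete = allVecs-complete m }
  where
  allVecs-unique : ∀ m → Unique (allVecs m n)
  allVecs-unique zero    = [] ∷ []
  allVecs-unique (suc m) = subst Unique (sym (concatMap-map≡cartesianProductWith _∷_ (allFin n) (allVecs m n)))
    (Unique.cartesianProductWith⁺ _∷_ ∷-injective (Unique.allFin⁺ n) (allVecs-unique m))
  allVecs-complete : ∀ m (v : Vec (Fin n) m) → v ∈ allVecs m n
  allVecs-complete zero    []      = here refl
  allVecs-complete (suc m) (x ∷ v) = ∈-concatMap⁺ (λ y → map (y ∷_) (allVecs m n))
    (Any.map (λ { refl → ∈-map⁺ (x ∷_) (allVecs-complete m v) }) (∈-allFin x))

module _ {A : Set} where

  Unique-toList⁻ : ∀ {m} {v : Vec A m} → Unique (toList v) → Vec.Unique v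
  Unique-toList⁻ {v = []}    []        = []
  Unique-toList⁻ {v = x ∷ v} (x∉ ∷ v!) = VecAll.toList⁻ x∉ ∷ Unique-toList⁻ v!

  Unique-toList⁺ : ∀ {m} {v : Vec A m} → Vec.Unique v → Unique (toList v)
  Unique-toList⁺ []        = []
  Unique-toList⁺ (x∉ ∷ v!) = VecAll.toList⁺ x∉ ∷ Unique-toList⁺ v!

  tabulate≡ : ∀ {m} {f : Fin m → A} {v : Vec A m} → (∀ i → f i ≡ lookup v i) → tabulate f ≡ v
  tabulate≡ {v = v} f≗v = trans (tabulate-cong f≗v) (tabulate∘lookup v)

module _ {n : ℕ} {σ : OneLine n} where

  IsPerm⇒injective : IsPerm σ → Injective _≡_ _≡_ (lookup σ)
  IsPerm⇒injective σ! = VecUnique.lookup-injective (Unique-toList⁻ σ!) _ _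

  injective⇒IsPerm : Injective _≡_ _≡_ (lookup σ) → IsPerm σ
  injective⇒IsPerm inj = Unique-toList⁺ (subst Vec.Unique (tabulate∘lookup σ) (VecUnique.tabulate⁺ inj))

-- Parity

%-+-congʳ : ∀ a x y → x % 2 ≡ y % 2 → (a + x) % 2 ≡ (a + y) % 2
%-+-congʳ a x y eq = begin
  (a + x) % 2          ≡⟨ %-distribˡ-+ a x 2 ⟩
  (a % 2 + x % 2) % 2  ≡⟨ cong (λ t → (a % 2 + t) % 2) eq ⟩
  (a % 2 + y % 2) % 2  ≡⟨ %-distribˡ-+ a y 2 ⟨
  (a + y) % 2          ∎
  where open ≡-Reasoning

%2-+-cancelʳ : ∀ u v {x y} → u + x ≡ v + y → x % 2 ≡ y % 2 → u % 2 ≡ v % 2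
%2-+-cancelʳ u v {x} {y} eq x≡y = begin
  u % 2            ≡⟨ +-twice u x ⟨
  (u + x + x) % 2  ≡⟨ cong (λ t → (t + x) % 2) eq ⟩
  (v + y + x) % 2  ≡⟨ %-+-congʳ (v + y) x y x≡y ⟩
  (v + y + y) % 2  ≡⟨ +-twice v y ⟩
  v % 2            ∎
  where
  open ≡-Reasoning
  +-twice : ∀ a b → (a + b + b) % 2 ≡ a % 2
  +-twice a b = trans (cong (_% 2) (trans (+-assoc a b b) (cong (λ t → a + (b + t)) (sym (+-identityʳ b)))))
    (trans (cong (λ t → (a + t) % 2) (*-comm 2 b)) ([m+kn]%n≡m%n a b 2))

m<⌊n/2⌋⇒1+m*2<n : ∀ {m} n → m < ⌊ n /2⌋ → suc (m * 2) < n
m<⌊n/2⌋⇒1+m*2<n {zero}  (suc (suc n)) _        = s≤s (s≤s z≤n)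
m<⌊n/2⌋⇒1+m*2<n {suc m} (suc (suc n)) (s≤s m<) = s<s (s<s (m<⌊n/2⌋⇒1+m*2<n n m<))

1+m*2<n⇒m<⌊n/2⌋ : ∀ {m} n → suc (m * 2) < n → m < ⌊ n /2⌋
1+m*2<n⇒m<⌊n/2⌋ {zero}  (suc zero)    (s≤s ())
1+m*2<n⇒m<⌊n/2⌋ {zero}  (suc (suc n)) _               = s≤s z≤n
1+m*2<n⇒m<⌊n/2⌋ {suc m} (suc (suc n)) (s≤s (s≤s m<)) = s≤s (1+m*2<n⇒m<⌊n/2⌋ n m<)

m<⌈n/2⌉⇒m*2<n : ∀ {m} n → m < ⌈ n /2⌉ → m * 2 < n
m<⌈n/2⌉⇒m*2<n n m< = s<s⁻¹ (m<⌊n/2⌋⇒1+m*2<n (suc n) m<)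

m*2<n⇒m<⌈n/2⌉ : ∀ {m} n → m * 2 < n → m < ⌈ n /2⌉
m*2<n⇒m<⌈n/2⌉ n m*2< = 1+m*2<n⇒m<⌊n/2⌋ (suc n) (s<s m*2<)

data EvenOdd : ℕ → Set where
  2*_   : ∀ m → EvenOdd (m * 2)
  1+2*_ : ∀ m → EvenOdd (suc (m * 2))

evenOdd : ∀ x → EvenOdd x
evenOdd zero          = 2* 0
evenOdd (suc zero)    = 1+2* 0
evenOdd (suc (suc x)) with evenOdd x
... | 2* m   = 2* suc m
... | 1+2* m = 1+2* suc m

-- Splitting a PAP into its odd and even positions

module ParitySplit (n : ℕ) where

  -- Indices are 0-based: `even` enumerates the paper's odd positions 1, 3, 5, …
  even : Fin ⌈ n /2⌉ → Fin n
  even a = fromℕ< (m<⌈n/2⌉⇒m*2<n n (toℕ<n a))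

  odd : Fin ⌊ n /2⌋ → Fin n
  odd b = fromℕ< (m<⌊n/2⌋⇒1+m*2<n n (toℕ<n b))

  toℕ-even : ∀ a → toℕ (even a) ≡ toℕ a * 2
  toℕ-even a = toℕ-fromℕ< _

  toℕ-odd : ∀ b → toℕ (odd b) ≡ suc (toℕ b * 2)
  toℕ-odd b = toℕ-fromℕ< _

  even-%2 : ∀ a → toℕ (even a) % 2 ≡ 0
  even-%2 a = trans (cong (_% 2) (toℕ-even a)) (m*n%n≡0 (toℕ a) 2)

  odd-%2 : ∀ b → toℕ (odd b) % 2 ≡ 1
  odd-%2 b = trans (cong (_% 2) (toℕ-odd b)) ([m+kn]%n≡m%n 1 (toℕ b) 2)

  even≢odd : ∀ a b → even a ≢ odd b
  even≢odd a b eq with () ← trans (sym (even-%2 a)) (trans (cong ((_% 2) ∘ toℕ) eq) (odd-%2 b))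

  even-injective : Injective _≡_ _≡_ even
  even-injective {a} {a′} eq = toℕ-injective (*-cancelʳ-≡ (toℕ a) (toℕ a′) 2
    (trans (sym (toℕ-even a)) (trans (cong toℕ eq) (toℕ-even a′))))

  odd-injective : Injective _≡_ _≡_ odd
  odd-injective {b} {b′} eq = toℕ-injective (*-cancelʳ-≡ (toℕ b) (toℕ b′) 2
    (suc-injective (trans (sym (toℕ-odd b)) (trans (cong toℕ eq) (toℕ-odd b′)))))

  even-mono-< : ∀ {a a′} → a Fin.< a′ → even a Fin.< even a′
  even-mono-< {a} {a′} a< = subst₂ _<_ (sym (toℕ-even a)) (sym (toℕ-even a′)) (*-monoˡ-< 2 a<)

  even-cancel-< : ∀ {a a′} → even a Fin.< even a′ → a Fin.< a′
  even-cancel-< {a} {a′} e< =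
    *-cancelʳ-< 2 (toℕ a) (toℕ a′) (subst₂ _<_ (toℕ-even a) (toℕ-even a′) e<)

  odd-mono-< : ∀ {b b′} → b Fin.< b′ → odd b Fin.< odd b′
  odd-mono-< {b} {b′} b< = subst₂ _<_ (sym (toℕ-odd b)) (sym (toℕ-odd b′)) (s<s (*-monoˡ-< 2 b<))

  odd-cancel-< : ∀ {b b′} → odd b Fin.< odd b′ → b Fin.< b′
  odd-cancel-< {b} {b′} o< =
    *-cancelʳ-< 2 (toℕ b) (toℕ b′) (s<s⁻¹ (subst₂ _<_ (toℕ-odd b) (toℕ-odd b′) o<))

  data ParityView (i : Fin n) : Set where
    even-index : ∀ a → i ≡ even a → ParityView i
    odd-index  : ∀ b → i ≡ odd b  → ParityView i

  parityView : ∀ i → ParityView i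
  parityView i = view (evenOdd (toℕ i)) refl
    where
    view : ∀ {x} → EvenOdd x → toℕ i ≡ x → ParityView i
    view (2* m) eq = even-index a (toℕ-injective (trans eq
      (trans (cong (_* 2) (sym (toℕ-fromℕ< m<))) (sym (toℕ-even a)))))
      where
      m< : m < ⌈ n /2⌉
      m< = m*2<n⇒m<⌈n/2⌉ n (subst (_< n) eq (toℕ<n i))
      a : Fin ⌈ n /2⌉
      a = fromℕ< m<
    view (1+2* m) eq = odd-index b (toℕ-injective (trans eq
      (trans (cong (suc ∘ (_* 2)) (sym (toℕ-fromℕ< m<))) (sym (toℕ-odd b)))))
      where
      m< : m < ⌊ n /2⌋
      m< = 1+m*2<n⇒m<⌊n/2⌋ n (subst (_< n) eq (toℕ<n i))
      b : Fin ⌊ n /2⌋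
      b = fromℕ< m<

  caseParity : {B : Set} → (Fin ⌈ n /2⌉ → B) → (Fin ⌊ n /2⌋ → B) → Fin n → B
  caseParity e o i with parityView i
  ... | even-index a _ = e a
  ... | odd-index  b _ = o b

  module _ {B : Set} (e : Fin ⌈ n /2⌉ → B) (o : Fin ⌊ n /2⌋ → B) where

    caseParity-even : ∀ a → caseParity e o (even a) ≡ e a
    caseParity-even a with parityView (even a)
    ... | even-index a′ eq = cong e (sym (even-injective eq))
    ... | odd-index  b  eq = ⊥-elim (even≢odd a b eq)

    caseParity-odd : ∀ b → caseParity e o (odd b) ≡ o b
    caseParity-odd b with parityView (odd b)
    ... | even-index a  eq = ⊥-elim (even≢odd a b (sym eq))
    ... | odd-index  b′ eq = cong o (sym (odd-injective eq))

  evensThenOdds : List (Fin n)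
  evensThenOdds = map even (allFin ⌈ n /2⌉) ++ map odd (allFin ⌊ n /2⌋)

  evensThenOdds-isEnumeration : IsEnumeration evensThenOdds
  evensThenOdds-isEnumeration = record
    { unique   = Unique.++⁺ (Unique.map⁺ even-injective (Unique.allFin⁺ _))
                            (Unique.map⁺ odd-injective (Unique.allFin⁺ _)) disjoint
    ; complete = every-index
    }
    where
    disjoint : ∀ {i} → ¬ (i ∈ map even (allFin ⌈ n /2⌉) × i ∈ map odd (allFin ⌊ n /2⌋))
    disjoint (i∈evens , i∈odds) with a , _ , refl ← ∈-map⁻ even i∈evens | b , _ , eq ← ∈-map⁻ odd i∈odds
      = even≢odd a b eq
    every-index : ∀ i → i ∈ evensThenOdds
    every-index i with parityView i
    ... | even-index a refl = ∈-++⁺ˡ (∈-map⁺ even (∈-allFin a))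
    ... | odd-index  b refl = ∈-++⁺ʳ (map even (allFin ⌈ n /2⌉)) (∈-map⁺ odd (∈-allFin b))

  count-allFin-evenOdd : {P : Fin n → Set} (P? : Decidable P) →
    count P? (allFin n) ≡ count (P? ∘ even) (allFin ⌈ n /2⌉) + count (P? ∘ odd) (allFin ⌊ n /2⌋)
  count-allFin-evenOdd P? = begin
    count P? (allFin n)
      ≡⟨ count-bijection P? P? (allFin-isEnumeration n) evensThenOdds-isEnumeration
                         id id id id (λ _ → refl) (λ _ → refl) ⟩
    count P? evensThenOdds
      ≡⟨ count-++ P? (map even (allFin ⌈ n /2⌉)) (map odd (allFin ⌊ n /2⌋)) ⟩
    count P? (map even (allFin ⌈ n /2⌉)) + count P? (map odd (allFin ⌊ n /2⌋))
      ≡⟨ cong₂ _+_ (count-map P? even (allFin ⌈ n /2⌉)) (count-map P? odd (allFin ⌊ n /2⌋)) ⟩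
    count (P? ∘ even) (allFin ⌈ n /2⌉) + count (P? ∘ odd) (allFin ⌊ n /2⌋) ∎
    where open ≡-Reasoning

  record Interleaving (σ : OneLine n) (α : OneLine ⌈ n /2⌉) (β : OneLine ⌊ n /2⌋) : Set where
    field
      on-even : ∀ a → lookup σ (even a) ≡ even (lookup α a)
      on-odd  : ∀ b → lookup σ (odd b) ≡ odd (lookup β b)

  open Interleaving

  merge : OneLine ⌈ n /2⌉ → OneLine ⌊ n /2⌋ → OneLine n
  merge α β = tabulate (caseParity (even ∘ lookup α) (odd ∘ lookup β))

  -- The defaults `const a` and `const b` are junk values, never reached when σ is a PAP.
  evenPart : OneLine n → OneLine ⌈ n /2⌉
  evenPart σ = tabulate (λ a → caseParity id (const a) (lookup σ (even a)))

  oddPart : OneLine n → OneLine ⌊ n /2⌋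
  oddPart σ = tabulate (λ b → caseParity (const b) id (lookup σ (odd b)))

  merge-interleaving : ∀ α β → Interleaving (merge α β) α β
  merge-interleaving α β = record
    { on-even = λ a → trans (lookup∘tabulate _ (even a)) (caseParity-even _ _ a)
    ; on-odd  = λ b → trans (lookup∘tabulate _ (odd b)) (caseParity-odd _ _ b)
    }

  split-interleaving : ∀ {σ} → IsPAP σ → Interleaving σ (evenPart σ) (oddPart σ)
  split-interleaving {σ} σ-pap = record
    { on-even = λ a → sym (trans (cong even (lookup∘tabulate _ a))
                         (even-caseParity (lookup σ (even a)) (trans (σ-pap (even a)) (even-%2 a))))
    ; on-odd  = λ b → sym (trans (cong odd (lookup∘tabulate _ b))
                         (odd-caseParity (lookup σ (odd b)) (trans (σ-pap (odd b)) (odd-%2 b))))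
    }
    where
    even-caseParity : ∀ {a₀} y → toℕ y % 2 ≡ 0 → even (caseParity id (const a₀) y) ≡ y
    even-caseParity y y%2 with parityView y
    ... | even-index a refl = refl
    ... | odd-index  b refl with () ← trans (sym y%2) (odd-%2 b)
    odd-caseParity : ∀ {b₀} y → toℕ y % 2 ≡ 1 → odd (caseParity (const b₀) id y) ≡ y
    odd-caseParity y y%2 with parityView y
    ... | even-index a refl with () ← trans (sym (even-%2 a)) y%2
    ... | odd-index  b refl = refl

  module _ {σ α β} (ι : Interleaving σ α β) where

    merge-unique : merge α β ≡ σ
    merge-unique = tabulate≡ λ i → merge-at i (parityView i)
      where
      merge-at : ∀ i → ParityView i → caseParity (even ∘ lookup α) (odd ∘ lookup β) i ≡ lookup σ i
      merge-at _ (even-index a refl) = trans (caseParity-even _ _ a) (sym (on-even ι a))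
      merge-at _ (odd-index  b refl) = trans (caseParity-odd _ _ b) (sym (on-odd ι b))

    evenPart-unique : evenPart σ ≡ α
    evenPart-unique = tabulate≡ λ a →
      trans (cong (caseParity id (const a)) (on-even ι a)) (caseParity-even id (const a) (lookup α a))

    oddPart-unique : oddPart σ ≡ β
    oddPart-unique = tabulate≡ λ b →
      trans (cong (caseParity (const b) id) (on-odd ι b)) (caseParity-odd (const b) id (lookup β b))

    interleaving-isPAP : IsPAP σ
    interleaving-isPAP i with parityView i
    ... | even-index a refl =
      trans (cong ((_% 2) ∘ toℕ) (on-even ι a)) (trans (even-%2 (lookup α a)) (sym (even-%2 a)))
    ... | odd-index  b refl =
      trans (cong ((_% 2) ∘ toℕ) (on-odd ι b)) (trans (odd-%2 (lookup β b)) (sym (odd-%2 b)))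

    isPermDerangement⁻ : IsPermDerangement σ → IsPermDerangement α × IsPermDerangement β
    isPermDerangement⁻ (σ! , σ-der) = (injective⇒IsPerm α-inj , α-der) , (injective⇒IsPerm β-inj , β-der)
      where
      σ-inj : Injective _≡_ _≡_ (lookup σ)
      σ-inj = IsPerm⇒injective σ!
      α-inj : Injective _≡_ _≡_ (lookup α)
      α-inj {a} {a′} eq = even-injective (σ-inj (trans (on-even ι a) (trans (cong even eq) (sym (on-even ι a′)))))
      β-inj : Injective _≡_ _≡_ (lookup β)
      β-inj {b} {b′} eq = odd-injective (σ-inj (trans (on-odd ι b) (trans (cong odd eq) (sym (on-odd ι b′)))))
      α-der : IsDerangement α
      α-der a eq = σ-der (even a) (trans (on-even ι a) (cong even eq))
      β-der : IsDerangement β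
      β-der b eq = σ-der (odd b) (trans (on-odd ι b) (cong odd eq))

    isPermDerangement⁺ : IsPermDerangement α → IsPermDerangement β → IsPermDerangement σ
    isPermDerangement⁺ (α! , α-der) (β! , β-der) = injective⇒IsPerm σ-inj , σ-der
      where
      σ-inj : Injective _≡_ _≡_ (lookup σ)
      σ-inj {i} {j} eq with parityView i | parityView j
      ... | even-index a refl | even-index a′ refl =
        cong even (IsPerm⇒injective α! (even-injective (trans (sym (on-even ι a)) (trans eq (on-even ι a′)))))
      ... | odd-index b refl  | odd-index b′ refl  =
        cong odd (IsPerm⇒injective β! (odd-injective (trans (sym (on-odd ι b)) (trans eq (on-odd ι b′)))))
      ... | even-index a refl | odd-index b refl   =
        ⊥-elim (even≢odd (lookup α a) (lookup β b) (trans (sym (on-even ι a)) (trans eq (on-odd ι b))))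
      ... | odd-index b refl  | even-index a refl  =
        ⊥-elim (even≢odd (lookup α a) (lookup β b) (trans (sym (on-even ι a)) (trans (sym eq) (on-odd ι b))))
      σ-der : IsDerangement σ
      σ-der i eq with parityView i
      ... | even-index a refl = α-der a (even-injective (trans (sym (on-even ι a)) eq))
      ... | odd-index  b refl = β-der b (odd-injective (trans (sym (on-odd ι b)) eq))

    exc-interleaving : exc σ ≡ exc α + exc β
    exc-interleaving = trans (count-allFin-evenOdd (λ i → i <? lookup σ i))
      (cong₂ _+_ (count-≐ _ _ (even-exc , even-exc⁻¹) (allFin ⌈ n /2⌉))
                 (count-≐ _ _ (odd-exc , odd-exc⁻¹) (allFin ⌊ n /2⌋)))
      where
      even-exc : ∀ {a} → even a Fin.< lookup σ (even a) → a Fin.< lookup α a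
      even-exc {a} lt = even-cancel-< (subst (even a Fin.<_) (on-even ι a) lt)
      even-exc⁻¹ : ∀ {a} → a Fin.< lookup α a → even a Fin.< lookup σ (even a)
      even-exc⁻¹ {a} lt = subst (even a Fin.<_) (sym (on-even ι a)) (even-mono-< lt)
      odd-exc : ∀ {b} → odd b Fin.< lookup σ (odd b) → b Fin.< lookup β b
      odd-exc {b} lt = odd-cancel-< (subst (odd b Fin.<_) (on-odd ι b) lt)
      odd-exc⁻¹ : ∀ {b} → b Fin.< lookup β b → odd b Fin.< lookup σ (odd b)
      odd-exc⁻¹ {b} lt = subst (odd b Fin.<_) (sym (on-odd ι b)) (odd-mono-< lt)

pad≡count-pairs : ∀ n k → pad n k ≡
  count ((isPermDerangement? ×? isPermDerangement?) ∩? (λ (α , β) → exc α + exc β ≟ k))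
        (cartesianProduct (allVecs ⌈ n /2⌉ ⌈ n /2⌉) (allVecs ⌊ n /2⌋ ⌊ n /2⌋))
pad≡count-pairs n k = count-bijection _ _
  (allVecs-isEnumeration n n)
  (cartesianProduct-isEnumeration (allVecs-isEnumeration _ _) (allVecs-isEnumeration _ _))
  split (uncurry merge) to from
  (λ (_ , σ-pap , _) → merge-unique (split-interleaving σ-pap))
  (λ {(α , β)} _ → let ι = merge-interleaving α β in cong₂ _,_ (evenPart-unique ι) (oddPart-unique ι))
  where
  open ParitySplit n
  split : OneLine n → OneLine ⌈ n /2⌉ × OneLine ⌊ n /2⌋
  split σ = evenPart σ , oddPart σ
  to : ∀ {σ} → IsPADWithExcedances k σ →
       (IsPermDerangement (evenPart σ) × IsPermDerangement (oddPart σ)) × exc (evenPart σ) + exc (oddPart σ) ≡ k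
  to {σ} (σ! , σ-pap , σ-der , exc≡k) =
    isPermDerangement⁻ ι (σ! , σ-der) , trans (sym (exc-interleaving ι)) exc≡k
    where
    ι : Interleaving σ (evenPart σ) (oddPart σ)
    ι = split-interleaving σ-pap
  from : ∀ {α β} → (IsPermDerangement α × IsPermDerangement β) × exc α + exc β ≡ k →
         IsPADWithExcedances k (merge α β)
  from {α} {β} ((α-pd , β-pd) , exc≡k) =
    proj₁ σ-pd , interleaving-isPAP ι , proj₂ σ-pd , trans (exc-interleaving ι) exc≡k
    where
    ι : Interleaving (merge α β) α β
    ι = merge-interleaving α β
    σ-pd : IsPermDerangement (merge α β)
    σ-pd = isPermDerangement⁺ ι α-pd β-pd

pad≡Σ0to : ∀ n k → pad n k ≡ Σ0to k (λ i → d ⌈ n /2⌉ i * d ⌊ n /2⌋ (k ∸ i))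
pad≡Σ0to n k =
  trans (pad≡count-pairs n k)
  (trans (count-convolution isPermDerangement? isPermDerangement? exc exc k
                            (allVecs ⌈ n /2⌉ ⌈ n /2⌉) (allVecs ⌊ n /2⌋ ⌊ n /2⌋))
         (Σ0to-cong k λ {i} _ → cong₂ _*_ (count≡d ⌈ n /2⌉ i) (count≡d ⌊ n /2⌋ (k ∸ i))))
  where
  count≡d : ∀ m i → count (isPermDerangement? ∩? ((_≟ i) ∘ exc)) (allVecs m m) ≡ d m i
  count≡d m i = count-≐ _ _ (assocʳ′ , assocˡ′) (allVecs m m)

-- Reverse complement

module _ {n : ℕ} where

  <-opposite-swap : ∀ {i j : Fin n} → i Fin.< opposite j → j Fin.< opposite i
  <-opposite-swap {i} {j} i< = subst (toℕ j <_) (sym (opposite-prop i))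
    (m+n≤o⇒m≤o∸n (suc (toℕ j)) (subst (_≤ n) (+-comm (suc (toℕ i)) (suc (toℕ j)))
      (m≤o∸n⇒m+n≤o (suc (toℕ i)) (toℕ<n j) (subst (toℕ i <_) (opposite-prop j) i<))))

  opposite-%2 : ∀ {i j : Fin n} → toℕ i % 2 ≡ toℕ j % 2 → toℕ (opposite i) % 2 ≡ toℕ (opposite j) % 2
  opposite-%2 {i} {j} i≡j = %2-+-cancelʳ (toℕ (opposite i)) (toℕ (opposite j))
    (trans (opposite+suc i) (sym (opposite+suc j))) (%-+-congʳ 1 (toℕ i) (toℕ j) i≡j)
    where
    opposite+suc : ∀ i → toℕ (opposite i) + suc (toℕ i) ≡ n
    opposite+suc i = trans (cong (_+ suc (toℕ i)) (opposite-prop i)) (m∸n+n≡m (toℕ<n i))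

  opposite-injective : Injective _≡_ _≡_ (opposite {n})
  opposite-injective {i} {j} eq =
    trans (sym (opposite-involutive i)) (trans (cong opposite eq) (opposite-involutive j))

  reverseComplement : OneLine n → OneLine n
  reverseComplement σ = tabulate (opposite ∘ lookup σ ∘ opposite)

  module _ (σ : OneLine n) where

    private
      lookup-rc : ∀ i → lookup (reverseComplement σ) i ≡ opposite (lookup σ (opposite i))
      lookup-rc = lookup∘tabulate (opposite ∘ lookup σ ∘ opposite)

    reverseComplement-involutive : reverseComplement (reverseComplement σ) ≡ σ
    reverseComplement-involutive = tabulate≡ λ i → begin
      opposite (lookup (reverseComplement σ) (opposite i))   ≡⟨ cong opposite (lookup-rc (opposite i)) ⟩
      opposite (opposite (lookup σ (opposite (opposite i)))) ≡⟨ opposite-involutive _ ⟩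
      lookup σ (opposite (opposite i))                       ≡⟨ cong (lookup σ) (opposite-involutive i) ⟩
      lookup σ i                                             ∎
      where open ≡-Reasoning

    reverseComplement-isPerm : IsPerm σ → IsPerm (reverseComplement σ)
    reverseComplement-isPerm σ! = injective⇒IsPerm λ {i} {j} eq → opposite-injective
      (IsPerm⇒injective σ! (opposite-injective (trans (sym (lookup-rc i)) (trans eq (lookup-rc j)))))

    reverseComplement-isDerangement : IsDerangement σ → IsDerangement (reverseComplement σ)
    reverseComplement-isDerangement σ-der i eq =
      σ-der (opposite i) (trans (sym (opposite-involutive _)) (cong opposite (trans (sym (lookup-rc i)) eq)))

    reverseComplement-isPAP : IsPAP σ → IsPAP (reverseComplement σ)
    reverseComplement-isPAP σ-pap i = begin
      toℕ (lookup (reverseComplement σ) i) % 2    ≡⟨ cong ((_% 2) ∘ toℕ) (lookup-rc i) ⟩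
      toℕ (opposite (lookup σ (opposite i))) % 2  ≡⟨ opposite-%2 (σ-pap (opposite i)) ⟩
      toℕ (opposite (opposite i)) % 2             ≡⟨ cong ((_% 2) ∘ toℕ) (opposite-involutive i) ⟩
      toℕ i % 2                                   ∎
      where open ≡-Reasoning

    exc-reverseComplement : IsDerangement σ → exc (reverseComplement σ) ≡ n ∸ exc σ
    exc-reverseComplement σ-der = begin
      exc (reverseComplement σ)
        ≡⟨ count-bijection _ _ (allFin-isEnumeration n) (allFin-isEnumeration n) opposite opposite
                           rc-exc⇒ ⇒rc-exc (λ _ → opposite-involutive _) (λ _ → opposite-involutive _) ⟩
      count (λ j → lookup σ j <? j) (allFin n)
        ≡⟨ count-≐ _ _ ((λ σj< j< → <-asym σj< j<) , ≯⇒<) (allFin n) ⟩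
      count (∁? (λ j → j <? lookup σ j)) (allFin n)
        ≡⟨ m+n∸m≡n (exc σ) _ ⟨
      exc σ + count (∁? (λ j → j <? lookup σ j)) (allFin n) ∸ exc σ
        ≡⟨ cong (_∸ exc σ) (trans (count-∁ _ (allFin n)) (length-tabulate id)) ⟩
      n ∸ exc σ ∎
      where
      open ≡-Reasoning
      rc-exc⇒ : ∀ {i} → i Fin.< lookup (reverseComplement σ) i → lookup σ (opposite i) Fin.< opposite i
      rc-exc⇒ {i} i< = <-opposite-swap (subst (i Fin.<_) (lookup-rc i) i<)
      ⇒rc-exc : ∀ {j} → lookup σ j Fin.< j → opposite j Fin.< lookup (reverseComplement σ) (opposite j)
      ⇒rc-exc {j} σj< = subst (opposite j Fin.<_) (sym (lookup-rc (opposite j)))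
        (<-opposite-swap (subst (λ t → lookup σ t Fin.< opposite (opposite j)) (sym (opposite-involutive j))
          (subst (lookup σ j Fin.<_) (sym (opposite-involutive j)) σj<)))
      ≯⇒< : ∀ {j} → ¬ (j Fin.< lookup σ j) → lookup σ j Fin.< j
      ≯⇒< {j} ≮ = ≤∧≢⇒< (≮⇒≥ ≮) (σ-der j)

pad-reverseComplement : ∀ n k → k ≤ n → pad n k ≡ pad n (n ∸ k)
pad-reverseComplement n k k≤n = count-bijection _ _ (allVecs-isEnumeration n n) (allVecs-isEnumeration n n)
  reverseComplement reverseComplement
  reverseComplement-PAD
  (subst (λ j → IsPADWithExcedances j _) (m∸[m∸n]≡n k≤n) ∘ reverseComplement-PAD)
  (λ _ → reverseComplement-involutive _) (λ _ → reverseComplement-involutive _)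
  where
  reverseComplement-PAD : ∀ {j} {σ : OneLine n} → IsPADWithExcedances j σ →
                          IsPADWithExcedances (n ∸ j) (reverseComplement σ)
  reverseComplement-PAD {σ = σ} (σ! , σ-pap , σ-der , refl) =
    reverseComplement-isPerm σ σ! , reverseComplement-isPAP σ σ-pap ,
    reverseComplement-isDerangement σ σ-der , exc-reverseComplement σ σ-der

exc-positive : ∀ {m} {σ : OneLine (suc m)} → IsDerangement σ → 0 < exc σ
exc-positive {σ = σ} σ-der = filter-some (λ i → i <? lookup σ i) (here (≤∧≢⇒< z≤n (σ-der zero ∘ sym)))

d-zero : ∀ m → d (suc m) 0 ≡ 0
d-zero m = count-none _ (allVecs (suc m) (suc m)) λ σ (_ , σ-der , exc≡0) →
  m<n⇒n≢0 (exc-positive {σ = σ} σ-der) exc≡0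

pad≡Σ1to : ∀ m k → 1 ≤ k →
  pad (suc (suc m)) k ≡ Σ1to (k ∸ 1) (λ i → d ⌈ suc (suc m) /2⌉ i * d ⌊ suc (suc m) /2⌋ (k ∸ i))
pad≡Σ1to m (suc k) _ = begin
  pad (suc (suc m)) (suc k)     ≡⟨ pad≡Σ0to (suc (suc m)) (suc k) ⟩
  g 0 + (Σ1to k g + g (suc k))  ≡⟨ cong₂ (λ x y → x + (Σ1to k g + y)) g0≡0 g1+k≡0 ⟩
  Σ1to k g + 0                  ≡⟨ +-identityʳ (Σ1to k g) ⟩
  Σ1to k g                      ∎
  where
  open ≡-Reasoning
  c f : ℕ
  c = ⌈ suc (suc m) /2⌉
  f = ⌊ suc (suc m) /2⌋
  g : ℕ → ℕ
  g i = d c i * d f (suc k ∸ i)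
  g0≡0 : g 0 ≡ 0
  g0≡0 = cong (_* d f (suc k)) (d-zero ⌈ m /2⌉)
  g1+k≡0 : g (suc k) ≡ 0
  g1+k≡0 = begin
    d c (suc k) * d f (k ∸ k)  ≡⟨ cong (λ t → d c (suc k) * d f t) (n∸n≡0 k) ⟩
    d c (suc k) * d f 0        ≡⟨ cong (d c (suc k) *_) (d-zero ⌊ m /2⌋) ⟩
    d c (suc k) * 0            ≡⟨ *-zeroʳ (d c (suc k)) ⟩
    0                          ∎

proposition6 : (n k : ℕ) → 4 ≤ n → 2 ≤ k → k ≤ n ∸ 2 →
    (k ≤ ⌊ n /2⌋ → pad n k ≡ Σ1to (k ∸ 1) (λ i → d ⌈ n /2⌉ i * d ⌊ n /2⌋ (k ∸ i)))
    × (⌊ n /2⌋ < k → pad n k ≡ Σ1to (n ∸ k ∸ 1) (λ i → d ⌈ n /2⌉ i * d ⌊ n /2⌋ (n ∸ k ∸ i)))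
proposition6 (suc (suc m)) k (s≤s (s≤s _)) 2≤k k≤m =
  (λ _ → pad≡Σ1to m k 1≤k) ,
  (λ _ → trans (pad-reverseComplement (suc (suc m)) k k≤n) (pad≡Σ1to m (suc (suc m) ∸ k) 1≤n∸k))
  where
  1≤k : 1 ≤ k
  1≤k = ≤-trans (s≤s z≤n) 2≤k
  k≤n : k ≤ suc (suc m)
  k≤n = m≤n⇒m≤1+n (m≤n⇒m≤1+n k≤m)
  1≤n∸k : 1 ≤ suc (suc m) ∸ k
  1≤n∸k = m<n⇒0<n∸m (s≤s (m≤n⇒m≤1+n k≤m))
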